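{- For every permutation $\sigma$, $\mathrm{crs}(rci(\sigma))=\mathrm{crs}(\sigma)$ and $\mathrm{nes}(rci(\sigma))=\mathrm{nes}(\sigma)$.
   Context: For $\sigma\in S_n$: reverse $r(\sigma)(j)=\sigma(n+1-j)$, complement $c(\sigma)(j)=n+1-\sigma(j)$, inverse $i(\sigma)=\sigma^{ -1}$, and $rci=r\circ c\circ i$, so $rci(\sigma)(n+1-\sigma(k))=n+1-k$. A crossing of $\sigma$ is a pair $(i,j)$ with $i<j<\sigma(i)<\sigma(j)$ or $\sigma(i)<\sigma(j)\le i<j$; a nesting is a pair $(i,j)$ with $i<j<\sigma(j)<\sigma(i)$ or $\sigma(j)<\sigma(i)\le i<j$; $\mathrm{crs}$ and $\mathrm{nes}$ count them. -}

module Defs where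

open import Data.Nat using (ℕ; _<_; _≤_; _<?_; _≤?_)
open import Data.Fin using (Fin; toℕ; opposite)
open import Data.Fin.Properties using (opposite-involutive)
open import Data.Fin.Permutation using (Permutation′; _⟨$⟩ʳ_; _⟨$⟩ˡ_; inverseˡ; inverseʳ; flip; _∘ₚ_)
open import Data.List using (List; allFin; concatMap; map; length; filter)
open import Data.Product using (_×_; _,_)
open import Data.Sum using (_⊎_)
open import Relation.Nullary using (Dec)
open import Relation.Nullary.Decidable using (_×-dec_; _⊎-dec_)
open import Relation.Binary.PropositionalEquality using (_≡_; cong; trans)
open import Function.Bundles using (mk↔ₛ′)

-- Positions/values 1..n of the paper are represented by Fin n (0..n-1);
-- j ↦ n+1-j corresponds to 'opposite'.

oppₚ : ∀ {n} → Permutation′ n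
oppₚ = mk↔ₛ′ opposite opposite opposite-involutive opposite-involutive

-- r(σ)(j) = σ(n+1-j)
rev : ∀ {n} → Permutation′ n → Permutation′ n
rev σ = oppₚ ∘ₚ σ

-- c(σ)(j) = n+1-σ(j)
comp : ∀ {n} → Permutation′ n → Permutation′ n
comp σ = σ ∘ₚ oppₚ

inv : ∀ {n} → Permutation′ n → Permutation′ n
inv σ = flip σ

rci : ∀ {n} → Permutation′ n → Permutation′ n
rci σ = rev (comp (inv σ))

pairs : ∀ n → List (Fin n × Fin n)
pairs n = concatMap (λ i → map (λ j → (i , j)) (allFin n)) (allFin n)

IsCrossing : ∀ {n} → Permutation′ n → Fin n × Fin n → Set
IsCrossing σ (i , j) =
  (toℕ i < toℕ j × toℕ j < toℕ (σ ⟨$⟩ʳ i) × toℕ (σ ⟨$⟩ʳ i) < toℕ (σ ⟨$⟩ʳ j))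
  ⊎ (toℕ (σ ⟨$⟩ʳ i) < toℕ (σ ⟨$⟩ʳ j) × toℕ (σ ⟨$⟩ʳ j) ≤ toℕ i × toℕ i < toℕ j)

IsNesting : ∀ {n} → Permutation′ n → Fin n × Fin n → Set
IsNesting σ (i , j) =
  (toℕ i < toℕ j × toℕ j < toℕ (σ ⟨$⟩ʳ j) × toℕ (σ ⟨$⟩ʳ j) < toℕ (σ ⟨$⟩ʳ i))
  ⊎ (toℕ (σ ⟨$⟩ʳ j) < toℕ (σ ⟨$⟩ʳ i) × toℕ (σ ⟨$⟩ʳ i) ≤ toℕ i × toℕ i < toℕ j)

isCrossing? : ∀ {n} (σ : Permutation′ n) (p : Fin n × Fin n) → Dec (IsCrossing σ p)
isCrossing? σ (i , j) =
  (toℕ i <? toℕ j ×-dec toℕ j <? toℕ (σ ⟨$⟩ʳ i) ×-dec toℕ (σ ⟨$⟩ʳ i) <? toℕ (σ ⟨$⟩ʳ j))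
  ⊎-dec (toℕ (σ ⟨$⟩ʳ i) <? toℕ (σ ⟨$⟩ʳ j) ×-dec toℕ (σ ⟨$⟩ʳ j) ≤? toℕ i ×-dec toℕ i <? toℕ j)

isNesting? : ∀ {n} (σ : Permutation′ n) (p : Fin n × Fin n) → Dec (IsNesting σ p)
isNesting? σ (i , j) =
  (toℕ i <? toℕ j ×-dec toℕ j <? toℕ (σ ⟨$⟩ʳ j) ×-dec toℕ (σ ⟨$⟩ʳ j) <? toℕ (σ ⟨$⟩ʳ i))
  ⊎-dec (toℕ (σ ⟨$⟩ʳ j) <? toℕ (σ ⟨$⟩ʳ i) ×-dec toℕ (σ ⟨$⟩ʳ i) ≤? toℕ i ×-dec toℕ i <? toℕ j)

crs : ∀ {n} → Permutation′ n → ℕ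
crs {n} σ = length (filter (isCrossing? σ) (pairs n))

nes : ∀ {n} → Permutation′ n → ℕ
nes {n} σ = length (filter (isNesting? σ) (pairs n))

module Submission where

-- Write ψ(k) = n+1-σ(k) (the permutation 'comp σ').  The defining
-- property of τ = rci σ is τ(ψ(k)) = n+1-k, so the graph {(k, σ k)} of σ is
-- carried onto the graph of τ by the point map (x, y) ↦ (n+1-y, n+1-x),
-- which reverses both coordinates and exchanges them.  Since j ↦ n+1-j
-- reverses the order of positions, this map sends
--   * a crossing (i, j) of σ to the crossing (ψ j, ψ i) of τ, and
--   * a nesting  (i, j) of σ to the nesting  (ψ i, ψ j) of τ,
-- and back again.  The counts therefore agree because ψ is a bijection.

open import Defs
open import Data.Nat using (ℕ; zero; suc; _+_; _<_; _≤_; s≤s)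
open import Data.Nat.Properties using (∸-monoʳ-<; ∸-monoʳ-≤; +-0-commutativeMonoid)
open import Data.Product using (_×_; _,_; swap)
open import Data.Sum using (_⊎_; inj₁; inj₂)
open import Data.Fin using (Fin; toℕ; opposite)
import Data.Fin as Fin
open import Data.Fin.Properties using (opposite-prop; opposite-involutive; toℕ<n)
open import Data.Fin.Permutation using (Permutation′; _⟨$⟩ʳ_; _⟨$⟩ˡ_; inverseˡ)
open import Data.List using (List; []; _∷_; _++_; concatMap; map; length; filter; tabulate; allFin)
import Data.Nat.ListAction as ListAction
open import Data.List.Properties using (length-++; filter-++; map-tabulate)
open import Function using (_∘_; _⇔_; mk⇔; Equivalence)
open import Relation.Nullary using (Dec; yes; no; contradiction)
open import Relation.Unary using (Pred; Decidable)
open import Relation.Binary.PropositionalEquality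
open import Algebra.Properties.CommutativeMonoid.Sum +-0-commutativeMonoid
  using (sum; sum-cong-≗; ∑-comm; ∑-permute)

open ≡-Reasoning

opposite-< : ∀ {n} {a b : Fin n} → toℕ a < toℕ b → toℕ (opposite b) < toℕ (opposite a)
opposite-< {n} {a} {b} a<b rewrite opposite-prop a | opposite-prop b =
  ∸-monoʳ-< (s≤s a<b) (toℕ<n b)

opposite-≤ : ∀ {n} {a b : Fin n} → toℕ a ≤ toℕ b → toℕ (opposite b) ≤ toℕ (opposite a)
opposite-≤ {n} {a} {b} a≤b rewrite opposite-prop a | opposite-prop b =
  ∸-monoʳ-≤ n (s≤s a≤b)

Cross : ∀ {n} → Fin n → Fin n → Fin n → Fin n → Set
Cross i j σi σj =
  (toℕ i < toℕ j × toℕ j < toℕ σi × toℕ σi < toℕ σj)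
  ⊎ (toℕ σi < toℕ σj × toℕ σj ≤ toℕ i × toℕ i < toℕ j)

Nest : ∀ {n} → Fin n → Fin n → Fin n → Fin n → Set
Nest i j σi σj =
  (toℕ i < toℕ j × toℕ j < toℕ σj × toℕ σj < toℕ σi)
  ⊎ (toℕ σj < toℕ σi × toℕ σi ≤ toℕ i × toℕ i < toℕ j)

module _ {n : ℕ} {i j σi σj : Fin n} where

  cross-mirror : Cross i j σi σj → Cross (opposite σj) (opposite σi) (opposite j) (opposite i)
  cross-mirror (inj₁ (i<j , j<σi , σi<σj)) =
    inj₁ (opposite-< σi<σj , opposite-< j<σi , opposite-< i<j)
  cross-mirror (inj₂ (σi<σj , σj≤i , i<j)) =
    inj₂ (opposite-< i<j , opposite-≤ σj≤i , opposite-< σi<σj)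

  nest-mirror : Nest i j σi σj → Nest (opposite σi) (opposite σj) (opposite i) (opposite j)
  nest-mirror (inj₁ (i<j , j<σj , σj<σi)) =
    inj₁ (opposite-< σj<σi , opposite-< j<σj , opposite-< i<j)
  nest-mirror (inj₂ (σj<σi , σi≤i , i<j)) =
    inj₂ (opposite-< i<j , opposite-≤ σi≤i , opposite-< σj<σi)

module _ {n : ℕ} {i j σi σj : Fin n} where

  -- The mirror map is an involution, so the converses follow from the lemmas above.
  cross-mirror⁻ : Cross (opposite σj) (opposite σi) (opposite j) (opposite i) → Cross i j σi σj
  cross-mirror⁻ c with cross-mirror c
  ... | c′ rewrite opposite-involutive i | opposite-involutive j
                 | opposite-involutive σi | opposite-involutive σj = c′

  nest-mirror⁻ : Nest (opposite σi) (opposite σj) (opposite i) (opposite j) → Nest i j σi σj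
  nest-mirror⁻ c with nest-mirror c
  ... | c′ rewrite opposite-involutive i | opposite-involutive j
                 | opposite-involutive σi | opposite-involutive σj = c′

rci-comp : ∀ {n} (σ : Permutation′ n) (k : Fin n) → rci σ ⟨$⟩ʳ (comp σ ⟨$⟩ʳ k) ≡ opposite k
rci-comp σ k = cong opposite (begin
  σ ⟨$⟩ˡ opposite (opposite (σ ⟨$⟩ʳ k)) ≡⟨ cong (σ ⟨$⟩ˡ_) (opposite-involutive _) ⟩
  σ ⟨$⟩ˡ (σ ⟨$⟩ʳ k)                     ≡⟨ inverseˡ σ ⟩
  k                                    ∎)

module _ {n : ℕ} (σ : Permutation′ n) (i j : Fin n) where

  private
    ψ : Fin n → Fin n
    ψ k = comp σ ⟨$⟩ʳ k

  crossing-rci : IsCrossing σ (i , j) ⇔ IsCrossing (rci σ) (ψ j , ψ i)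
  crossing-rci = mk⇔
    (λ c → subst₂ (Cross (ψ j) (ψ i)) (sym (rci-comp σ j)) (sym (rci-comp σ i)) (cross-mirror c))
    (λ c → cross-mirror⁻ (subst₂ (Cross (ψ j) (ψ i)) (rci-comp σ j) (rci-comp σ i) c))

  nesting-rci : IsNesting σ (i , j) ⇔ IsNesting (rci σ) (ψ i , ψ j)
  nesting-rci = mk⇔
    (λ c → subst₂ (Nest (ψ i) (ψ j)) (sym (rci-comp σ i)) (sym (rci-comp σ j)) (nest-mirror c))
    (λ c → nest-mirror⁻ (subst₂ (Nest (ψ i) (ψ j)) (rci-comp σ i) (rci-comp σ j) c))

𝟙 : ∀ {p} {P : Set p} → Dec P → ℕ
𝟙 (yes _) = 1
𝟙 (no _)  = 0

𝟙-cong : ∀ {p q} {P : Set p} {Q : Set q} → P ⇔ Q → (P? : Dec P) (Q? : Dec Q) → 𝟙 P? ≡ 𝟙 Q?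
𝟙-cong _ (yes _) (yes _) = refl
𝟙-cong P⇔Q (yes p) (no ¬q) = contradiction (Equivalence.to P⇔Q p) ¬q
𝟙-cong P⇔Q (no ¬p) (yes q) = contradiction (Equivalence.from P⇔Q q) ¬p
𝟙-cong _ (no _)  (no _)  = refl

sum-tabulate : ∀ {n} (f : Fin n → ℕ) → ListAction.sum (tabulate f) ≡ sum f
sum-tabulate {zero}  f = refl
sum-tabulate {suc n} f = cong (f Fin.zero +_) (sum-tabulate (f ∘ Fin.suc))

module _ {a p} {A : Set a} {P : Pred A p} (P? : Decidable P) where

  length-filter-tabulate : ∀ {n} (g : Fin n → A) →
    length (filter P? (tabulate g)) ≡ sum (λ k → 𝟙 (P? (g k)))
  length-filter-tabulate {zero}  g = refl
  length-filter-tabulate {suc n} g with P? (g Fin.zero)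
  ... | yes _ = cong suc (length-filter-tabulate (g ∘ Fin.suc))
  ... | no _  = length-filter-tabulate (g ∘ Fin.suc)

  length-filter-concatMap : ∀ {b} {B : Set b} (g : B → List A) (xs : List B) →
    length (filter P? (concatMap g xs)) ≡ ListAction.sum (map (λ x → length (filter P? (g x))) xs)
  length-filter-concatMap g []       = refl
  length-filter-concatMap g (x ∷ xs) = begin
    length (filter P? (g x ++ concatMap g xs))
      ≡⟨ cong length (filter-++ P? (g x) (concatMap g xs)) ⟩
    length (filter P? (g x) ++ filter P? (concatMap g xs))
      ≡⟨ length-++ (filter P? (g x)) ⟩
    length (filter P? (g x)) + length (filter P? (concatMap g xs))
      ≡⟨ cong (length (filter P? (g x)) +_) (length-filter-concatMap g xs) ⟩
    ListAction.sum (map (λ y → length (filter P? (g y))) (x ∷ xs)) ∎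

module _ {n : ℕ} where

  count : ∀ {p} {P : Pred (Fin n × Fin n) p} → Decidable P → ℕ
  count P? = length (filter P? (pairs n))

  count-pairs : ∀ {p} {P : Pred (Fin n × Fin n) p} (P? : Decidable P) →
    count P? ≡ sum (λ i → sum (λ j → 𝟙 (P? (i , j))))
  count-pairs P? = begin
    length (filter P? (concatMap row (allFin n)))
      ≡⟨ length-filter-concatMap P? row (allFin n) ⟩
    ListAction.sum (map (λ i → length (filter P? (row i))) (allFin n))
      ≡⟨ cong ListAction.sum (map-tabulate (λ i → i) (λ i → length (filter P? (row i)))) ⟩
    ListAction.sum (tabulate (λ i → length (filter P? (row i))))
      ≡⟨ sum-tabulate (λ i → length (filter P? (row i))) ⟩
    sum (λ i → length (filter P? (row i)))
      ≡⟨ sum-cong-≗ (λ i → cong (length ∘ filter P?) (map-tabulate (λ j → j) (i ,_))) ⟩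
    sum (λ i → length (filter P? (tabulate (i ,_))))
      ≡⟨ sum-cong-≗ (λ i → length-filter-tabulate P? (i ,_)) ⟩
    sum (λ i → sum (λ j → 𝟙 (P? (i , j)))) ∎
    where
    row : Fin n → List (Fin n × Fin n)
    row i = map (λ j → (i , j)) (allFin n)

  module _ {p q} {P : Pred (Fin n × Fin n) p} {Q : Pred (Fin n × Fin n) q}
           (P? : Decidable P) (Q? : Decidable Q) where

    count-reindex : (π : Permutation′ n) →
      (∀ i j → P (i , j) ⇔ Q (π ⟨$⟩ʳ i , π ⟨$⟩ʳ j)) → count P? ≡ count Q?
    count-reindex π P⇔Q = begin
      count P?
        ≡⟨ count-pairs P? ⟩
      sum (λ i → sum (λ j → 𝟙 (P? (i , j))))
        ≡⟨ sum-cong-≗ (λ i → sum-cong-≗ (λ j → 𝟙-cong (P⇔Q i j) _ _)) ⟩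
      sum (λ i → sum (λ j → 𝟙 (Q? (π ⟨$⟩ʳ i , π ⟨$⟩ʳ j))))
        ≡⟨ sum-cong-≗ (λ i → ∑-permute (λ b → 𝟙 (Q? (π ⟨$⟩ʳ i , b))) π) ⟨
      sum (λ i → sum (λ b → 𝟙 (Q? (π ⟨$⟩ʳ i , b))))
        ≡⟨ ∑-permute (λ a → sum (λ b → 𝟙 (Q? (a , b)))) π ⟨
      sum (λ a → sum (λ b → 𝟙 (Q? (a , b))))
        ≡⟨ count-pairs Q? ⟨
      count Q? ∎

  count-swap : ∀ {p} {P : Pred (Fin n × Fin n) p} (P? : Decidable P) →
    count (P? ∘ swap) ≡ count P?
  count-swap P? = begin
    count (P? ∘ swap)                        ≡⟨ count-pairs (P? ∘ swap) ⟩
    sum (λ i → sum (λ j → 𝟙 (P? (j , i))))  ≡⟨ ∑-comm (λ i j → 𝟙 (P? (j , i))) ⟩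
    sum (λ j → sum (λ i → 𝟙 (P? (j , i))))  ≡⟨ count-pairs P? ⟨
    count P?                                 ∎

lemma4p2 : (n : ℕ) (σ : Permutation′ n) → (crs (rci σ) ≡ crs σ) × (nes (rci σ) ≡ nes σ)
lemma4p2 n σ = crs-rci , nes-rci
  where
  crs-rci : crs (rci σ) ≡ crs σ
  crs-rci = begin
    crs (rci σ)                          ≡⟨ count-swap (isCrossing? (rci σ)) ⟨
    count (isCrossing? (rci σ) ∘ swap)   ≡⟨ count-reindex (isCrossing? σ) (isCrossing? (rci σ) ∘ swap)
                                              (comp σ) (crossing-rci σ) ⟨
    crs σ                                ∎

  nes-rci : nes (rci σ) ≡ nes σ
  nes-rci = sym (count-reindex (isNesting? σ) (isNesting? (rci σ)) (comp σ) (nesting-rci σ))
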